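{- Let $h_1\ge\dots\ge h_n>0$ be integers with $n\ge2$, $N=h_1+\dots+h_n$, and $h_1=N/2$. Then a $\mathrm{LC}(h_1h_2\dots h_n)$ exists if and only if a $\mathrm{LC}(h_2\dots h_n)$ exists.
   Context: A latin cube of order $M$ is an $M\times M\times M$ array on $M$ symbols such that any two cells whose coordinates differ in exactly one position contain different symbols; a subcube is an $m\times m\times m$ subarray (indices in each coordinate from chosen $m$-sets) that is itself a latin cube of order $m$; subcubes are disjoint if they share no index in any coordinate and no symbol. For positive integers $k_1\ge\dots\ge k_r$, a $\mathrm{LC}(k_1\dots k_r)$ is a latin cube of order $\sum k_i$ with pairwise disjoint subcubes of orders $k_1,\dots,k_r$. -}

module Defs where

open import Data.Nat using (ℕ; _≥_; _<_)
open import Data.Fin using (Fin)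
open import Data.List using (List; length; lookup)
open import Data.Nat.ListAction using (sum)
open import Data.Product using (Σ; ∃; _×_)
open import Relation.Binary.PropositionalEquality using (_≡_; _≢_)
open import Function.Definitions using (Injective)

record LatinCube (M : ℕ) : Set where
  field
    cell  : Fin M → Fin M → Fin M → Fin M
    inj₁  : ∀ j k → Injective _≡_ _≡_ (λ i → cell i j k)
    inj₂  : ∀ i k → Injective _≡_ _≡_ (λ j → cell i j k)
    inj₃  : ∀ i j → Injective _≡_ _≡_ (λ k → cell i j k)

-- An m × m × m subcube of a latin cube L of order M: m-sets of indices in each
-- coordinate (given as injective maps Fin m → Fin M) together with an m-set of
-- symbols (injective map Fin m → Fin M) such that every entry of the subarray
-- lies in the symbol set; i.e. the subarray is a latin cube of order m
-- (latinness is inherited from L).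
record SubCube {M : ℕ} (L : LatinCube M) (m : ℕ) : Set where
  field
    row   : Fin m → Fin M
    col   : Fin m → Fin M
    fil   : Fin m → Fin M
    sym   : Fin m → Fin M
    row-inj : Injective _≡_ _≡_ row
    col-inj : Injective _≡_ _≡_ col
    fil-inj : Injective _≡_ _≡_ fil
    sym-inj : Injective _≡_ _≡_ sym
    closed  : ∀ i j k → ∃ λ s → LatinCube.cell L (row i) (col j) (fil k) ≡ sym s

DisjointImages : ∀ {a b M : ℕ} → (Fin a → Fin M) → (Fin b → Fin M) → Set
DisjointImages f g = ∀ x y → f x ≢ g y

Disjoint : ∀ {M a b} {L : LatinCube M} → SubCube L a → SubCube L b → Set
Disjoint A B =
  DisjointImages (SubCube.row A) (SubCube.row B) ×
  DisjointImages (SubCube.col A) (SubCube.col B) ×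
  DisjointImages (SubCube.fil A) (SubCube.fil B) ×
  DisjointImages (SubCube.sym A) (SubCube.sym B)

record LC (ks : List ℕ) : Set where
  field
    cube     : LatinCube (sum ks)
    sub      : (i : Fin (length ks)) → SubCube cube (lookup ks i)
    disjoint : ∀ i j → i ≢ j → Disjoint (sub i) (sub j)

data NonIncreasing : List ℕ → Set where
  []  : NonIncreasing List.[]
  [_] : ∀ x → NonIncreasing (x List.∷ List.[])
  _∷_ : ∀ {x y ys} → x ≥ y → NonIncreasing (y List.∷ ys) → NonIncreasing (x List.∷ y List.∷ ys)

-- Let A be the subcube of order s = h₂ + ⋯ + hₙ in a latin cube of order 2s.  A line
-- meeting A in s cells carries the s symbols of A there, so its other s cells carry the
-- other s symbols.  Used along rows, then columns, then files, this shows that the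
-- indices outside A span a latin cube on the symbols outside A, containing the remaining
-- subcubes.  Conversely, stack two copies of an LC(h₂ … hₙ), the layer of each symbol
-- being the parity of the layers of its three coordinates: the bottom copy is then a
-- subcube of order s, disjoint from the top copies of the small subcubes.
module Submission where

open import Defs
open import Data.Nat using (ℕ; _*_; _<_; _≥_; _+_; suc)
open import Data.List using (List; []; _∷_; length; lookup)
open import Data.Nat.ListAction using (sum)
open import Data.List.Relation.Unary.All using (All)
open import Relation.Binary.PropositionalEquality
  using (_≡_; _≢_; refl; sym; trans; cong; cong₂; subst; module ≡-Reasoning)
open import Function.Bundles using (_⇔_; mk⇔; Injection)
open import Data.Bool using (Bool; true; false; _xor_)
open import Data.Bool.Properties using (xor-assoc; xor-comm; xor-same; xor-identityʳ)
open import Data.Empty using (⊥-elim)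
open import Data.Fin using (Fin; zero; suc; _↑ˡ_; _↑ʳ_; splitAt; punchOut)
open import Data.Fin.Properties
  using (any?; injective⇒≤; punchOut-injective; suc-injective; splitAt-↑ˡ; splitAt-↑ʳ; join-splitAt; +↔⊎; _≟_)
open import Data.Nat.Properties using (1+n≰n; +-cancelˡ-≡; +-identityʳ)
open import Data.Product using (∃; _×_; _,_; proj₁; proj₂; uncurry)
open import Data.Product.Properties using (,-injectiveˡ; ,-injectiveʳ)
open import Data.Sum using (_⊎_; inj₁; inj₂; [_,_]′)
open import Data.Vec.Functional using (Vector; _++_)
open import Data.Vec.Functional.Properties using (lookup-++ˡ; lookup-++ʳ)
open import Function using (_∘_)
open import Function.Properties.Inverse using (Inverse⇒Injection)
open import Function.Definitions using (Injective; StrictlySurjective)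
open import Relation.Nullary using (yes; no; contradiction)

private
  variable
    m n p q M : ℕ

DisjointImages-sym : {f : Fin m → Fin M} {g : Fin n → Fin M} → DisjointImages f g → DisjointImages g f
DisjointImages-sym f∥g x y = f∥g y x ∘ sym

injective⇒strictlySurjective : {f : Fin n → Fin n} → Injective _≡_ _≡_ f → StrictlySurjective _≡_ f
injective⇒strictlySurjective {suc n} {f} f-inj y with any? (λ x → f x ≟ y)
... | yes hit = hit
... | no miss = contradiction (injective⇒≤ punchOut∘f-injective) 1+n≰n
  where
  y≢f : ∀ x → y ≢ f x
  y≢f x e = miss (x , sym e)

  punchOut∘f-injective : Injective _≡_ _≡_ (λ x → punchOut (y≢f x))
  punchOut∘f-injective e = f-inj (punchOut-injective (y≢f _) (y≢f _) e)

++-injective : {f : Vector (Fin M) m} {g : Vector (Fin M) n} →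
               Injective _≡_ _≡_ f → Injective _≡_ _≡_ g → DisjointImages f g →
               Injective _≡_ _≡_ (f ++ g)
++-injective {m = m} {f = f} {g} f-inj g-inj f∥g e =
  Injection.injective (Inverse⇒Injection (+↔⊎ {m})) ([,]-injective _ _ e)
  where
  [,]-injective : ∀ u v → [ f , g ]′ u ≡ [ f , g ]′ v → u ≡ v
  [,]-injective (inj₁ x) (inj₁ y) e = cong inj₁ (f-inj e)
  [,]-injective (inj₁ x) (inj₂ y) e = ⊥-elim (f∥g x y e)
  [,]-injective (inj₂ x) (inj₁ y) e = ⊥-elim (f∥g y x (sym e))
  [,]-injective (inj₂ x) (inj₂ y) e = cong inj₂ (g-inj e)

++-disjoint : {g : Fin p → Fin M} {f : Vector (Fin M) m} {f′ : Vector (Fin M) n} →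
              DisjointImages g f → DisjointImages g f′ → DisjointImages g (f ++ f′)
++-disjoint {m = m} g∥f g∥f′ x y with splitAt m y
... | inj₁ u = g∥f x u
... | inj₂ v = g∥f′ x v

++-cover : {f : Vector (Fin M) m} {g : Vector (Fin M) n} →
           ∀ y → (∃ λ t → (f ++ g) t ≡ y) → (∃ λ x → f x ≡ y) ⊎ (∃ λ x → g x ≡ y)
++-cover {m = m} y (t , e) with splitAt m t
... | inj₁ x = inj₁ (x , e)
... | inj₂ x = inj₂ (x , e)

disjoint-injections-cover : {f : Fin m → Fin (m + n)} {g : Fin n → Fin (m + n)} →
                            Injective _≡_ _≡_ f → Injective _≡_ _≡_ g → DisjointImages f g →
                            ∀ y → (∃ λ x → f x ≡ y) ⊎ (∃ λ x → g x ≡ y)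
disjoint-injections-cover f-inj g-inj f∥g y =
  ++-cover y (injective⇒strictlySurjective (++-injective f-inj g-inj f∥g) y)

concatBlocks : (hs : List ℕ) → ((i : Fin (length hs)) → Vector (Fin M) (lookup hs i)) → Vector (Fin M) (sum hs)
concatBlocks [] F = λ ()
concatBlocks (h ∷ hs) F = F zero ++ concatBlocks hs (F ∘ suc)

block : (hs : List ℕ) (i : Fin (length hs)) → Fin (lookup hs i) → Fin (sum hs)
block (h ∷ hs) zero x = x ↑ˡ sum hs
block (h ∷ hs) (suc i) x = h ↑ʳ block hs i x

concatBlocks-block : ∀ hs F i x → concatBlocks {M} hs F (block hs i x) ≡ F i x
concatBlocks-block (h ∷ hs) F zero x = lookup-++ˡ (F zero) (concatBlocks hs (F ∘ suc)) x
concatBlocks-block (h ∷ hs) F (suc i) x =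
  trans (lookup-++ʳ (F zero) (concatBlocks hs (F ∘ suc)) (block hs i x)) (concatBlocks-block hs (F ∘ suc) i x)

concatBlocks-disjoint : ∀ hs {F} {g : Fin p → Fin M} →
                        (∀ i → DisjointImages g (F i)) → DisjointImages g (concatBlocks hs F)
concatBlocks-disjoint [] g∥F x ()
concatBlocks-disjoint (h ∷ hs) g∥F = ++-disjoint (g∥F zero) (concatBlocks-disjoint hs (g∥F ∘ suc))

concatBlocks-injective : ∀ hs {F : (i : Fin (length hs)) → Vector (Fin M) (lookup hs i)} →
                         (∀ i → Injective _≡_ _≡_ (F i)) → (∀ i j → i ≢ j → DisjointImages (F i) (F j)) →
                         Injective _≡_ _≡_ (concatBlocks hs F)
concatBlocks-injective [] F-inj F∥F {()}
concatBlocks-injective (h ∷ hs) F-inj F∥F =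
  ++-injective (F-inj zero)
               (concatBlocks-injective hs (F-inj ∘ suc) (λ i j i≢j → F∥F (suc i) (suc j) (i≢j ∘ suc-injective)))
               (concatBlocks-disjoint hs (λ i → F∥F zero (suc i) λ ()))

-- ℓ ∘ a and Q are disjoint injections of total size m + n, so they exhaust the line,
-- and the cells c, which ℓ ∘ a misses, must carry symbols in Q.
line-complement : (ℓ : Fin (m + n) → Fin (m + n)) (a : Fin m → Fin (m + n)) (c : Fin q → Fin (m + n))
                  (P : Fin p → Fin (m + n)) (Q : Fin n → Fin (m + n)) →
                  Injective _≡_ _≡_ ℓ → Injective _≡_ _≡_ a → Injective _≡_ _≡_ Q →
                  DisjointImages a c → DisjointImages P Q →
                  (∀ x → ∃ λ u → ℓ (a x) ≡ P u) → ∀ y → ∃ λ v → ℓ (c y) ≡ Q v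
line-complement ℓ a c P Q ℓ-inj a-inj Q-inj a∥c P∥Q ℓa⊆P y =
  [ (λ (x , e) → ⊥-elim (a∥c x y (ℓ-inj e))) , (λ (v , e) → v , sym e) ]′
  (disjoint-injections-cover (a-inj ∘ ℓ-inj) Q-inj ℓa∥Q (ℓ (c y)))
  where
  ℓa∥Q : DisjointImages (ℓ ∘ a) Q
  ℓa∥Q x v e = P∥Q (proj₁ (ℓa⊆P x)) v (trans (sym (proj₂ (ℓa⊆P x))) e)

data Axis : Set where
  axis₁ axis₂ axis₃ symbols : Axis

Closed : (L : LatinCube M) → (Axis → Fin m → Fin M) → Set
Closed L π = ∀ i j k → ∃ λ s → LatinCube.cell L (π axis₁ i) (π axis₂ j) (π axis₃ k) ≡ π symbols s

module _ {L : LatinCube M} where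
  open LatinCube L using (cell)

  cell-cong : ∀ {x x′ y y′ z z′} → x ≡ x′ → y ≡ y′ → z ≡ z′ → cell x y z ≡ cell x′ y′ z′
  cell-cong refl refl refl = refl

  at : Axis → SubCube L m → Fin m → Fin M
  at axis₁   = SubCube.row
  at axis₂   = SubCube.col
  at axis₃   = SubCube.fil
  at symbols = SubCube.sym

  at-injective : ∀ a (C : SubCube L m) → Injective _≡_ _≡_ (at a C)
  at-injective axis₁   = SubCube.row-inj
  at-injective axis₂   = SubCube.col-inj
  at-injective axis₃   = SubCube.fil-inj
  at-injective symbols = SubCube.sym-inj

  disjoint-at : {C : SubCube L m} {D : SubCube L n} → Disjoint C D → ∀ a → DisjointImages (at a C) (at a D)
  disjoint-at (rows , cols , fils , syms) axis₁   = rows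
  disjoint-at (rows , cols , fils , syms) axis₂   = cols
  disjoint-at (rows , cols , fils , syms) axis₃   = fils
  disjoint-at (rows , cols , fils , syms) symbols = syms

  subCube : (π : Axis → Fin m → Fin M) → (∀ a → Injective _≡_ _≡_ (π a)) → Closed L π → SubCube L m
  subCube π π-inj π-closed = record
    { row = π axis₁ ; col = π axis₂ ; fil = π axis₃ ; sym = π symbols
    ; row-inj = π-inj axis₁ ; col-inj = π-inj axis₂ ; fil-inj = π-inj axis₃ ; sym-inj = π-inj symbols
    ; closed = π-closed
    }

  toLatinCube : SubCube L m → LatinCube m
  toLatinCube C = record
    { cell = λ i j k → proj₁ (closed i j k)
    ; inj₁ = λ j k e → row-inj (cell-inj₁ (col j) (fil k) (cell-≡ e))
    ; inj₂ = λ i k e → col-inj (cell-inj₂ (row i) (fil k) (cell-≡ e))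
    ; inj₃ = λ i j e → fil-inj (cell-inj₃ (row i) (col j) (cell-≡ e))
    }
    where
    open LatinCube L using () renaming (inj₁ to cell-inj₁; inj₂ to cell-inj₂; inj₃ to cell-inj₃)
    open SubCube C using (row; col; fil; closed; row-inj; col-inj; fil-inj)

    cell-≡ : ∀ {i j k i′ j′ k′} → proj₁ (closed i j k) ≡ proj₁ (closed i′ j′ k′) →
             cell (row i) (col j) (fil k) ≡ cell (row i′) (col j′) (fil k′)
    cell-≡ {i} {j} {k} {i′} {j′} {k′} e =
      trans (proj₂ (closed i j k)) (trans (cong (SubCube.sym C) e) (sym (proj₂ (closed i′ j′ k′))))

  record _⊆_ (D : SubCube L m) (C : SubCube L n) : Set where
    field
      embed    : Axis → Fin m → Fin n
      at-embed : ∀ a x → at a C (embed a x) ≡ at a D x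

  embed-≡ : {C : SubCube L n} {D : SubCube L m} {D′ : SubCube L p} (w : D ⊆ C) (w′ : D′ ⊆ C) →
            ∀ a {x y} → _⊆_.embed w a x ≡ _⊆_.embed w′ a y → at a D x ≡ at a D′ y
  embed-≡ {C = C} w w′ a {x} {y} e = trans (sym (at-embed w a x)) (trans (cong (at a C) e) (at-embed w′ a y))
    where open _⊆_

module _ {L : LatinCube M} {C : SubCube L n} where
  open LatinCube L using (cell)
  open _⊆_

  restrict : {D : SubCube L m} → D ⊆ C → SubCube (toLatinCube C) m
  restrict {D = D} w = subCube (embed w) (λ a → at-injective a D ∘ embed-≡ w w a) embed-closed
    where
    open ≡-Reasoning
    embed-closed : ∀ i j k → ∃ λ s →
                   proj₁ (SubCube.closed C (embed w axis₁ i) (embed w axis₂ j) (embed w axis₃ k)) ≡ embed w symbols s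
    embed-closed i j k with SubCube.closed C (embed w axis₁ i) (embed w axis₂ j) (embed w axis₃ k)
                          | SubCube.closed D i j k
    ... | t , cellC≡t | s , cellD≡s = s , SubCube.sym-inj C (begin
      SubCube.sym C t                                                   ≡⟨ cellC≡t ⟨
      cell (SubCube.row C (embed w axis₁ i)) (SubCube.col C (embed w axis₂ j)) (SubCube.fil C (embed w axis₃ k))
        ≡⟨ cell-cong {L = L} (at-embed w axis₁ i) (at-embed w axis₂ j) (at-embed w axis₃ k) ⟩
      cell (SubCube.row D i) (SubCube.col D j) (SubCube.fil D k)        ≡⟨ cellD≡s ⟩
      SubCube.sym D s                                                   ≡⟨ at-embed w symbols s ⟨
      SubCube.sym C (embed w symbols s)                                 ∎)

  restrict-disjoint : {D : SubCube L m} {D′ : SubCube L p} (w : D ⊆ C) (w′ : D′ ⊆ C) →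
                      Disjoint D D′ → Disjoint (restrict w) (restrict w′)
  restrict-disjoint w w′ D∥D′ =
    embed-disjoint axis₁ , embed-disjoint axis₂ , embed-disjoint axis₃ , embed-disjoint symbols
    where
    embed-disjoint : ∀ a → DisjointImages (embed w a) (embed w′ a)
    embed-disjoint a x y = disjoint-at D∥D′ a x y ∘ embed-≡ w w′ a

remove-largest : ∀ hs → LC (sum hs ∷ hs) → LC hs
remove-largest hs lc = record
  { cube     = toLatinCube complement
  ; sub      = λ i → restrict (B⊆complement i)
  ; disjoint = λ i j i≢j → restrict-disjoint (B⊆complement i) (B⊆complement j) (B∥B i j i≢j)
  }
  where
  open LC lc using (cube; sub)
  open LatinCube cube using (cell) renaming (inj₁ to cell-inj₁; inj₂ to cell-inj₂; inj₃ to cell-inj₃)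

  A : SubCube cube (sum hs)
  A = sub zero

  B : (i : Fin (length hs)) → SubCube cube (lookup hs i)
  B = sub ∘ suc

  B∥B : ∀ i j → i ≢ j → Disjoint (B i) (B j)
  B∥B i j i≢j = LC.disjoint lc (suc i) (suc j) (i≢j ∘ suc-injective)

  inside : Axis → Fin (sum hs) → Fin (sum hs + sum hs)
  inside a = at a A

  outside : Axis → Fin (sum hs) → Fin (sum hs + sum hs)
  outside a = concatBlocks hs (λ i → at a (B i))

  outside-injective : ∀ a → Injective _≡_ _≡_ (outside a)
  outside-injective a =
    concatBlocks-injective hs (λ i → at-injective a (B i)) (λ i j i≢j → disjoint-at (B∥B i j i≢j) a)

  inside∥outside : ∀ a → DisjointImages (inside a) (outside a)
  inside∥outside a = concatBlocks-disjoint hs (λ i → disjoint-at (LC.disjoint lc zero (suc i) λ ()) a)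

  outside-closed : Closed cube outside
  outside-closed i j k =
    line-complement (cell (outside axis₁ i) (outside axis₂ j))
      (inside axis₃) (outside axis₃) (inside symbols) (outside symbols)
      (cell-inj₃ (outside axis₁ i) (outside axis₂ j)) (at-injective axis₃ A) (outside-injective symbols)
      (inside∥outside axis₃) (inside∥outside symbols) in-A k
    where
    in-outside : ∀ j′ k′ → ∃ λ t → cell (outside axis₁ i) (inside axis₂ j′) (inside axis₃ k′) ≡ outside symbols t
    in-outside j′ k′ =
      line-complement (λ r → cell r (inside axis₂ j′) (inside axis₃ k′))
        (inside axis₁) (outside axis₁) (inside symbols) (outside symbols)
        (cell-inj₁ (inside axis₂ j′) (inside axis₃ k′)) (at-injective axis₁ A) (outside-injective symbols)
        (inside∥outside axis₁) (inside∥outside symbols) (λ r → SubCube.closed A r j′ k′) i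

    in-A : ∀ k′ → ∃ λ u → cell (outside axis₁ i) (outside axis₂ j) (inside axis₃ k′) ≡ inside symbols u
    in-A k′ =
      line-complement (λ c → cell (outside axis₁ i) c (inside axis₃ k′))
        (inside axis₂) (outside axis₂) (outside symbols) (inside symbols)
        (cell-inj₂ (outside axis₁ i) (inside axis₃ k′)) (at-injective axis₂ A) (at-injective symbols A)
        (inside∥outside axis₂) (DisjointImages-sym (inside∥outside symbols)) (λ j′ → in-outside j′ k′) j

  complement : SubCube cube (sum hs)
  complement = subCube outside outside-injective outside-closed

  at-complement : ∀ a x → at a complement x ≡ outside a x
  at-complement axis₁   x = refl
  at-complement axis₂   x = refl
  at-complement axis₃   x = refl
  at-complement symbols x = refl

  B⊆complement : ∀ i → B i ⊆ complement
  B⊆complement i = record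
    { embed    = λ _ → block hs i
    ; at-embed = λ a x → trans (at-complement a (block hs i x)) (concatBlocks-block hs (λ i → at a (B i)) i x)
    }

xor-involutiveʳ : ∀ a c → (a xor c) xor c ≡ a
xor-involutiveʳ a c = trans (xor-assoc a c c) (trans (cong (a xor_) (xor-same c)) (xor-identityʳ a))

xor-cancelʳ : ∀ c {a b} → a xor c ≡ b xor c → a ≡ b
xor-cancelʳ c {a} {b} e = begin
  a                ≡⟨ xor-involutiveʳ a c ⟨
  (a xor c) xor c  ≡⟨ cong (_xor c) e ⟩
  (b xor c) xor c  ≡⟨ xor-involutiveʳ b c ⟩
  b                ∎
  where open ≡-Reasoning

xor-cancelˡ : ∀ c {a b} → c xor a ≡ c xor b → a ≡ b
xor-cancelˡ c {a} {b} e = xor-cancelʳ c (trans (xor-comm a c) (trans e (xor-comm c b)))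

xor-thrice : ∀ b → b xor b xor b ≡ b
xor-thrice false = refl
xor-thrice true  = refl

layer : Bool → Fin n → Fin (n + n)
layer {n} false u = u ↑ˡ n
layer {n} true  u = n ↑ʳ u

unlayer : Fin (n + n) → Bool × Fin n
unlayer {n} x = [ (false ,_) , (true ,_) ]′ (splitAt n x)

unlayer-layer : ∀ (p : Bool × Fin n) → unlayer {n} (uncurry layer p) ≡ p
unlayer-layer {n} (false , u) = cong [ (false ,_) , (true ,_) ]′ (splitAt-↑ˡ n u n)
unlayer-layer {n} (true  , u) = cong [ (false ,_) , (true ,_) ]′ (splitAt-↑ʳ n n u)

layer-unlayer : ∀ (x : Fin (n + n)) → uncurry layer (unlayer {n} x) ≡ x
layer-unlayer {n} x = trans (layer-[,] (splitAt n x)) (join-splitAt n n x)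
  where
  layer-[,] : ∀ v → uncurry layer ([ (false ,_) , (true ,_) ]′ v) ≡ [ _↑ˡ n , n ↑ʳ_ ]′ v
  layer-[,] (inj₁ u) = refl
  layer-[,] (inj₂ u) = refl

layer-injective : Injective _≡_ _≡_ (uncurry (layer {n}))
layer-injective {n} {x = p} {q} e = trans (sym (unlayer-layer p)) (trans (cong (unlayer {n}) e) (unlayer-layer q))

layer-injectiveʳ : ∀ b → Injective _≡_ _≡_ (layer {n} b)
layer-injectiveʳ b {u} {v} e = ,-injectiveʳ (layer-injective {x = b , u} {b , v} e)

unlayer-injective : Injective _≡_ _≡_ (unlayer {n})
unlayer-injective {n} {x = x} {y} e =
  trans (sym (layer-unlayer {n} x)) (trans (cong (uncurry (layer {n})) e) (layer-unlayer {n} y))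

module _ (L : LatinCube n) where
  open LatinCube L using (cell) renaming (inj₁ to cell-inj₁; inj₂ to cell-inj₂; inj₃ to cell-inj₃)

  stack : Bool × Fin n → Bool × Fin n → Bool × Fin n → Bool × Fin n
  stack (a , u) (b , v) (c , w) = a xor b xor c , cell u v w

  stack-inj₁ : ∀ {p p′} q r → stack p q r ≡ stack p′ q r → p ≡ p′
  stack-inj₁ (b , v) (c , w) e = cong₂ _,_ (xor-cancelʳ (b xor c) (,-injectiveˡ e)) (cell-inj₁ v w (,-injectiveʳ e))

  stack-inj₂ : ∀ p {q q′} r → stack p q r ≡ stack p q′ r → q ≡ q′
  stack-inj₂ (a , u) (c , w) e = cong₂ _,_ (xor-cancelʳ c (xor-cancelˡ a (,-injectiveˡ e))) (cell-inj₂ u w (,-injectiveʳ e))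

  stack-inj₃ : ∀ p q {r r′} → stack p q r ≡ stack p q r′ → r ≡ r′
  stack-inj₃ (a , u) (b , v) e = cong₂ _,_ (xor-cancelˡ b (xor-cancelˡ a (,-injectiveˡ e))) (cell-inj₃ u v (,-injectiveʳ e))

  double : LatinCube (n + n)
  double = record
    { cell = λ x y z → uncurry layer (stack (unlayer x) (unlayer y) (unlayer z))
    ; inj₁ = λ j k e → unlayer-injective (stack-inj₁ (unlayer j) (unlayer k) (layer-injective e))
    ; inj₂ = λ i k e → unlayer-injective (stack-inj₂ (unlayer i) (unlayer k) (layer-injective e))
    ; inj₃ = λ i j e → unlayer-injective (stack-inj₃ (unlayer i) (unlayer j) (layer-injective e))
    }

  double-layer : ∀ a b c u v w →
                 LatinCube.cell double (layer a u) (layer b v) (layer c w) ≡ layer (a xor b xor c) (cell u v w)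
  double-layer a b c u v w rewrite unlayer-layer (a , u) | unlayer-layer (b , v) | unlayer-layer (c , w) = refl

  whole : SubCube L n
  whole = subCube (λ _ x → x) (λ _ e → e) (λ i j k → cell i j k , refl)

  lift : Bool → SubCube L m → SubCube double m
  lift b D = subCube (λ a → layer b ∘ at a D) lift-injective lift-closed
    where
    lift-injective : ∀ a → Injective _≡_ _≡_ (layer b ∘ at a D)
    lift-injective a = at-injective a D ∘ layer-injectiveʳ b

    lift-closed : Closed double (λ a → layer b ∘ at a D)
    lift-closed i j k with SubCube.closed D i j k
    ... | s , cellD≡s = s , (begin
      LatinCube.cell double (layer b (SubCube.row D i)) (layer b (SubCube.col D j)) (layer b (SubCube.fil D k))
        ≡⟨ double-layer b b b _ _ _ ⟩
      layer (b xor b xor b) (cell (SubCube.row D i) (SubCube.col D j) (SubCube.fil D k))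
        ≡⟨ cong₂ layer (xor-thrice b) cellD≡s ⟩
      layer b (SubCube.sym D s) ∎)
      where open ≡-Reasoning

  lift-disjoint : ∀ b (D : SubCube L m) b′ (D′ : SubCube L p) →
                  (∀ a x y → layer b (at a D x) ≢ layer b′ (at a D′ y)) → Disjoint (lift b D) (lift b′ D′)
  lift-disjoint _ _ _ _ layers∥ = layers∥ axis₁ , layers∥ axis₂ , layers∥ axis₃ , layers∥ symbols

layer-false≢true : {u v : Fin n} → layer false u ≢ layer true v
layer-false≢true {u = u} {v} e with ,-injectiveˡ (layer-injective {x = false , u} {true , v} e)
... | ()

add-largest : ∀ hs → LC hs → LC (sum hs ∷ hs)
add-largest hs lc = record { cube = double cube ; sub = sub′ ; disjoint = disjoint′ }
  where
  open LC lc using (cube; sub; disjoint)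

  sub′ : (i : Fin (length (sum hs ∷ hs))) → SubCube (double cube) (lookup (sum hs ∷ hs) i)
  sub′ zero    = lift cube false (whole cube)
  sub′ (suc i) = lift cube true (sub i)

  disjoint′ : ∀ i j → i ≢ j → Disjoint (sub′ i) (sub′ j)
  disjoint′ zero    zero    i≢j = ⊥-elim (i≢j refl)
  disjoint′ zero    (suc j) _   = lift-disjoint cube false (whole cube) true (sub j) λ _ _ _ → layer-false≢true
  disjoint′ (suc i) zero    _   = lift-disjoint cube true (sub i) false (whole cube) λ _ _ _ → layer-false≢true ∘ sym
  disjoint′ (suc i) (suc j) i≢j = lift-disjoint cube true (sub i) true (sub j) λ a x y →
    disjoint-at (disjoint i j (i≢j ∘ cong suc)) a x y ∘ layer-injectiveʳ true

LC-sum∷⇔LC : ∀ hs → LC (sum hs ∷ hs) ⇔ LC hs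
LC-sum∷⇔LC hs = mk⇔ (remove-largest hs) (add-largest hs)

theorem12 : (h₁ : ℕ) (hs : List ℕ) → length hs ≥ 1 → NonIncreasing (h₁ ∷ hs) → All (0 <_) (h₁ ∷ hs)
            → 2 * h₁ ≡ sum (h₁ ∷ hs) → LC (h₁ ∷ hs) ⇔ LC hs
theorem12 h₁ hs _ _ _ 2h₁≡h₁+rest = subst (λ h → LC (h ∷ hs) ⇔ LC hs) (sym h₁≡rest) (LC-sum∷⇔LC hs)
  where
  h₁≡rest : h₁ ≡ sum hs
  h₁≡rest = trans (sym (+-identityʳ h₁)) (+-cancelˡ-≡ h₁ _ _ 2h₁≡h₁+rest)
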